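{- Let $H$ be any configuration of the $(k,\ell)$-pebble game with colors, with $0\le\ell\le 2k-1$. For each $i=1,\dots,k$, let $H_i$ be the subgraph of $H$ formed by the edges carrying pebbles of color $c_i$. Then $H_i$ is $(1,0)$-sparse.
   Context: A graph is $(1,0)$-sparse if every subgraph with $n'$ vertices has at most $n'$ edges. The $(k,\ell)$-pebble game with colors is played on a fixed finite vertex set $V$. Its state is a directed multigraph $H$ on $V$ (loops allowed) together with pebbles, each having one of $k$ colors $c_1,\dots,c_k$. Each pebble lies on a vertex or on an edge, and every edge carries exactly one pebble. Initially $H$ has no edges and each vertex carries one pebble of each color. Moves: (add-edge) Let $v,w$ be vertices, not necessarily distinct, whose set $\{v,w\}$ carries at least $\ell+1$ pebbles in total, with $v$ carrying at least one pebble. Pick up a pebble from $v$, add the directed edge $vw$, and put that pebble on it. (pebble-slide) Let $w$ carry a pebble $p$ and let $vw$ be an edge. Replace $vw$ by $wv$, put the pebble from $vw$ onto $v$, and put $p$ on $wv$. A configuration is any state reachable from the initial one by finitely many moves. -}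

module Defs where

open import Data.Nat using (ℕ; zero; suc; _+_; _∸_; _≤_; _<_; _*_)
open import Data.Fin using (Fin; _≟_)
open import Data.Fin.Subset using (Subset; _∈_; ∣_∣)
open import Data.Vec using (tabulate)
open import Data.Vec.Properties using ()
open import Data.List using (List; []; _∷_; length; filter)
open import Data.List.Relation.Unary.All using (All)
open import Data.List.Relation.Unary.Any using (_─_)
open import Data.List.Membership.Propositional using () renaming (_∈_ to _∈ₗ_)
open import Data.List.Relation.Binary.Sublist.Propositional using (_⊆_)
open import Data.Product using (_×_; _,_)
open import Relation.Binary.PropositionalEquality using (_≡_)
open import Relation.Nullary using (yes; no)
import Data.Vec as Vec

record PEdge (n k : ℕ) : Set where
  constructor edge
  field
    tail  : Fin n
    head  : Fin n
    color : Fin k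
open PEdge public

-- A state of the (k,ℓ)-pebble game with colors on vertex set Fin n:
-- the directed multigraph H (as a list = multiset of edges, each with the
-- color of the pebble it carries), and, for each vertex v and color c,
-- the number of pebbles of color c lying on v.
record GameState (n k : ℕ) : Set where
  constructor state
  field
    edges : List (PEdge n k)
    free  : Fin n → Fin k → ℕ
open GameState public

pebblesOn : ∀ {n k} → GameState n k → Fin n → ℕ
pebblesOn {k = k} s v = Vec.sum (tabulate {n = k} (λ c → free s v c))

pebblesOnPair : ∀ {n k} → GameState n k → Fin n → Fin n → ℕ
pebblesOnPair s v w with v ≟ w
... | yes _ = pebblesOn s v
... | no  _ = pebblesOn s v + pebblesOn s w

update : ∀ {n k} → (Fin n → Fin k → ℕ) → Fin n → Fin k → (ℕ → ℕ) → Fin n → Fin k → ℕ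
update f v c g v' c' with v ≟ v' | c ≟ c'
... | yes _ | yes _ = g (f v' c')
... | _     | _     = f v' c'

initialState : ∀ {n k} → GameState n k
initialState = state [] (λ _ _ → 1)

data Move {n k : ℕ} (ℓ : ℕ) : GameState n k → GameState n k → Set where
  add-edge : ∀ (s : GameState n k) (v w : Fin n) (c : Fin k) →
    1 ≤ free s v c →
    suc ℓ ≤ pebblesOnPair s v w →
    Move ℓ s (state (edge v w c ∷ edges s) (update (free s) v c (λ m → m ∸ 1)))
  -- pebble-slide: w carries a pebble of color c', vw an edge carrying a
  -- pebble of color c; replace vw by wv, the pebble of vw goes onto v,
  -- and the pebble from w goes onto wv.
  pebble-slide : ∀ (s : GameState n k) (v w : Fin n) (c c' : Fin k) →
    1 ≤ free s w c' →
    (e : edge v w c ∈ₗ edges s) →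
    Move ℓ s (state (edge w v c' ∷ (edges s ─ e))
                    (update (update (free s) w c' (λ m → m ∸ 1)) v c suc))

data Configuration {n k : ℕ} (ℓ : ℕ) : GameState n k → Set where
  initial : Configuration ℓ initialState
  step    : ∀ {s t} → Configuration ℓ s → Move ℓ s t → Configuration ℓ t

-- H_i: the edges of H carrying pebbles of color i (as undirected multigraph
-- edges given by their endpoints).
colorEdges : ∀ {n k} → GameState n k → Fin k → List (Fin n × Fin n)
colorEdges s i = go (edges s)
  where
  go : _ → _
  go [] = []
  go (edge a b c ∷ es) with c ≟ i
  ... | yes _ = (a , b) ∷ go es
  ... | no  _ = go es

Sparse10 : ∀ {n} → List (Fin n × Fin n) → Set
Sparse10 {n} E = (S : Subset n) (F : List (Fin n × Fin n)) →
  F ⊆ E → All (λ { (a , b) → (a ∈ S) × (b ∈ S) }) F →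
  length F ≤ ∣ S ∣

-- Every vertex v owns exactly one pebble of each colour c, and every move keeps
-- that pebble either on v or on an edge leaving v: add-edge moves it from v onto
-- an edge out of v, and pebble-slide returns the pebble of vw to v while the pebble
-- taken from w goes onto wv, which leaves w.  Hence in H_i every vertex is the
-- tail of at most one edge, and any subgraph on a vertex set S has at most |S|
-- edges, since each of them is counted by its tail in S.
module Submission where

open import Defs
open import Algebra.Properties.CommutativeSemigroup using (x∙yz≈y∙xz)
open import Data.Nat using (ℕ; zero; suc; _+_; _∸_; _*_; _≤_; _<_; z≤n)
open import Data.Nat.Properties
  using (+-suc; +-assoc; +-comm; +-identityʳ; +-commutativeSemigroup; +-mono-≤; ≤-trans; m≤n+m; m∸n+n≡m)
open import Data.Fin using (Fin; zero; suc; _≟_)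
open import Data.Fin.Subset using (Subset; _∈_; ∣_∣; inside; outside)
open import Data.Vec using ([]; _∷_; there)
open import Data.List using (List; []; _∷_; length; filter; map)
open import Data.List.Properties using (length-map; filter-accept; filter-reject)
open import Data.List.Membership.Propositional using () renaming (_∈_ to _∈ₗ_)
open import Data.List.Relation.Unary.All as All using (All; []; _∷_)
import Data.List.Relation.Unary.All.Properties as All
open import Data.List.Relation.Unary.Any using (here; there; _─_)
open import Data.List.Relation.Binary.Sublist.Propositional using (_⊆_)
open import Data.List.Relation.Binary.Sublist.Propositional.Properties using (filter⁺; length-mono-≤; map⁺)
open import Data.Product using (_×_; proj₁)
open import Relation.Binary.PropositionalEquality
  using (_≡_; refl; cong; trans; sym; subst; subst₂; module ≡-Reasoning)
open import Relation.Nullary using (yes; no)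

open ≡-Reasoning

multiplicity : ∀ {n} → Fin n → List (Fin n) → ℕ
multiplicity v xs = length (filter (_≟ v) xs)

AtMostOnce : ∀ {n} → List (Fin n) → Set
AtMostOnce xs = ∀ v → multiplicity v xs ≤ 1

multiplicity-mono : ∀ {n} (v : Fin n) {xs ys} → xs ⊆ ys → multiplicity v xs ≤ multiplicity v ys
multiplicity-mono v xs⊆ys = length-mono-≤ (filter⁺ (_≟ v) (_≟ v) (λ { refl x≡v → x≡v }) xs⊆ys)

lower : ∀ {n} → List (Fin (suc n)) → List (Fin n)
lower []           = []
lower (zero ∷ xs)  = lower xs
lower (suc x ∷ xs) = x ∷ lower xs

length-lower : ∀ {n} (xs : List (Fin (suc n))) → length xs ≡ multiplicity zero xs + length (lower xs)
length-lower []           = refl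
length-lower (zero ∷ xs)  = cong suc (length-lower xs)
length-lower (suc x ∷ xs) = trans (cong suc (length-lower xs)) (sym (+-suc (multiplicity zero xs) _))

multiplicity-lower : ∀ {n} (v : Fin n) (xs : List (Fin (suc n))) →
  multiplicity v (lower xs) ≡ multiplicity (suc v) xs
multiplicity-lower v []           = refl
multiplicity-lower v (zero ∷ xs)  = multiplicity-lower v xs
multiplicity-lower v (suc x ∷ xs) with x ≟ v
... | yes _ = cong suc (multiplicity-lower v xs)
... | no _  = multiplicity-lower v xs

lower-atMostOnce : ∀ {n} (xs : List (Fin (suc n))) → AtMostOnce xs → AtMostOnce (lower xs)
lower-atMostOnce xs once v = subst (_≤ 1) (sym (multiplicity-lower v xs)) (once (suc v))

lower-∈ : ∀ {n b} {S : Subset n} {xs : List (Fin (suc n))} → All (_∈ b ∷ S) xs → All (_∈ S) (lower xs)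
lower-∈ {xs = []}         []                 = []
lower-∈ {xs = zero ∷ xs}  (_ ∷ xs∈S)         = lower-∈ xs∈S
lower-∈ {xs = suc x ∷ xs} (there x∈S ∷ xs∈S) = x∈S ∷ lower-∈ xs∈S

multiplicity-outside : ∀ {n} {S : Subset n} {xs : List (Fin (suc n))} →
  All (_∈ outside ∷ S) xs → multiplicity zero xs ≡ 0
multiplicity-outside {xs = []}         []         = refl
multiplicity-outside {xs = suc x ∷ xs} (_ ∷ xs∈S) = multiplicity-outside xs∈S

atMostOnce⇒length≤∣S∣ : ∀ {n} (S : Subset n) (xs : List (Fin n)) →
  All (_∈ S) xs → AtMostOnce xs → length xs ≤ ∣ S ∣
atMostOnce⇒length≤∣S∣ []            []  _    _    = z≤n
atMostOnce⇒length≤∣S∣ (inside ∷ S)  xs  xs∈S once rewrite length-lower xs =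
  +-mono-≤ (once zero) (atMostOnce⇒length≤∣S∣ S (lower xs) (lower-∈ xs∈S) (lower-atMostOnce xs once))
atMostOnce⇒length≤∣S∣ (outside ∷ S) xs  xs∈S once
  rewrite length-lower xs | multiplicity-outside {S = S} xs∈S =
  atMostOnce⇒length≤∣S∣ S (lower xs) (lower-∈ xs∈S) (lower-atMostOnce xs once)

tails : ∀ {n} → List (Fin n × Fin n) → List (Fin n)
tails = map proj₁

atMostOnce-tails⇒Sparse10 : ∀ {n} {E : List (Fin n × Fin n)} → AtMostOnce (tails E) → Sparse10 E
atMostOnce-tails⇒Sparse10 once S F F⊆E F⊆S =
  subst (_≤ ∣ S ∣) (length-map proj₁ F)
    (atMostOnce⇒length≤∣S∣ S (tails F) (All.map⁺ (All.map proj₁ F⊆S))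
      (λ v → ≤-trans (multiplicity-mono v (map⁺ proj₁ F⊆E)) (once v)))

-- Decided in the same order as update, so that both compute together.
indicator : ∀ {n k} → Fin n → Fin k → Fin n → Fin k → ℕ
indicator v c x y with v ≟ x | c ≟ y
... | yes _ | yes _ = 1
... | _     | _     = 0

outdegree : ∀ {n k} → List (PEdge n k) → Fin n → Fin k → ℕ
outdegree []       x y = 0
outdegree (e ∷ es) x y = indicator (tail e) (color e) x y + outdegree es x y

outdegree-─ : ∀ {n k} {a b : Fin n} {c : Fin k} {es} (e : edge a b c ∈ₗ es) x y →
  outdegree es x y ≡ indicator a c x y + outdegree (es ─ e) x y
outdegree-─ (here refl) x y = refl
outdegree-─ {a = a} {c = c} {es = e′ ∷ es} (there e) x y = begin
  indicator (tail e′) (color e′) x y + outdegree es x y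
    ≡⟨ cong (indicator (tail e′) (color e′) x y +_) (outdegree-─ e x y) ⟩
  indicator (tail e′) (color e′) x y + (indicator a c x y + outdegree (es ─ e) x y)
    ≡⟨ x∙yz≈y∙xz +-commutativeSemigroup (indicator (tail e′) (color e′) x y) (indicator a c x y) _ ⟩
  indicator a c x y + (indicator (tail e′) (color e′) x y + outdegree (es ─ e) x y) ∎

update-suc : ∀ {n k} (f : Fin n → Fin k → ℕ) v c x y →
  update f v c suc x y ≡ indicator v c x y + f x y
update-suc f v c x y with v ≟ x | c ≟ y
... | yes _ | yes _ = refl
... | yes _ | no _  = refl
... | no _  | _     = refl

update-pred : ∀ {n k} (f : Fin n → Fin k → ℕ) v c x y → 1 ≤ f v c →
  update f v c (λ m → m ∸ 1) x y + indicator v c x y ≡ f x y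
update-pred f v c x y 1≤fvc with v ≟ x | c ≟ y
... | yes refl | yes refl = m∸n+n≡m 1≤fvc
... | yes _    | no _     = +-identityʳ (f x y)
... | no _     | _        = +-identityʳ (f x y)

slide-pebble : ∀ {n k} (f : Fin n → Fin k → ℕ) v w c c′ x y → 1 ≤ f w c′ →
  update (update f w c′ (λ m → m ∸ 1)) v c suc x y + indicator w c′ x y ≡ indicator v c x y + f x y
slide-pebble f v w c c′ x y 1≤fwc′ = begin
  update f′ v c suc x y + indicator w c′ x y         ≡⟨ cong (_+ indicator w c′ x y) (update-suc f′ v c x y) ⟩
  indicator v c x y + f′ x y + indicator w c′ x y    ≡⟨ +-assoc (indicator v c x y) _ _ ⟩
  indicator v c x y + (f′ x y + indicator w c′ x y)  ≡⟨ cong (indicator v c x y +_) (update-pred f w c′ x y 1≤fwc′) ⟩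
  indicator v c x y + f x y                          ∎
  where f′ = update f w c′ (λ m → m ∸ 1)

ownedPebbles : ∀ {n k} → GameState n k → Fin n → Fin k → ℕ
ownedPebbles s v c = free s v c + outdegree (edges s) v c

move-preserves-ownedPebbles : ∀ {n k ℓ} {s t : GameState n k} → Move ℓ s t →
  ∀ x y → ownedPebbles t x y ≡ ownedPebbles s x y
move-preserves-ownedPebbles (add-edge s v w c 1≤fvc _) x y = begin
  f′ x y + (indicator v c x y + outdegree (edges s) x y)  ≡⟨ +-assoc (f′ x y) _ _ ⟨
  f′ x y + indicator v c x y + outdegree (edges s) x y    ≡⟨ cong (_+ outdegree (edges s) x y) (update-pred (free s) v c x y 1≤fvc) ⟩
  free s x y + outdegree (edges s) x y                    ∎
  where f′ = update (free s) v c (λ m → m ∸ 1)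
move-preserves-ownedPebbles (pebble-slide s v w c c′ 1≤fwc′ e) x y = begin
  f′ x y + (indicator w c′ x y + rest)     ≡⟨ +-assoc (f′ x y) _ _ ⟨
  f′ x y + indicator w c′ x y + rest       ≡⟨ cong (_+ rest) (slide-pebble (free s) v w c c′ x y 1≤fwc′) ⟩
  indicator v c x y + free s x y + rest    ≡⟨ cong (_+ rest) (+-comm (indicator v c x y) _) ⟩
  free s x y + indicator v c x y + rest    ≡⟨ +-assoc (free s x y) _ _ ⟩
  free s x y + (indicator v c x y + rest)  ≡⟨ cong (free s x y +_) (outdegree-─ e x y) ⟨
  free s x y + outdegree (edges s) x y     ∎
  where
  f′   = update (update (free s) w c′ (λ m → m ∸ 1)) v c suc
  rest = outdegree (edges s ─ e) x y

configuration-ownedPebbles : ∀ {n k ℓ} {s : GameState n k} → Configuration ℓ s →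
  ∀ x y → ownedPebbles s x y ≡ 1
configuration-ownedPebbles initial       x y = refl
configuration-ownedPebbles (step C move) x y =
  trans (move-preserves-ownedPebbles move x y) (configuration-ownedPebbles C x y)

multiplicity-tails-colorEdges : ∀ {n k} (es : List (PEdge n k)) f i v →
  multiplicity v (tails (colorEdges (state es f) i)) ≡ outdegree es v i
multiplicity-tails-colorEdges []                f i v = refl
multiplicity-tails-colorEdges (edge a b c ∷ es) f i v with c ≟ i | a ≟ v
... | yes _ | yes a≡v =
  trans (cong length (filter-accept (_≟ v) a≡v)) (cong suc (multiplicity-tails-colorEdges es f i v))
... | yes _ | no a≢v  =
  trans (cong length (filter-reject (_≟ v) a≢v)) (multiplicity-tails-colorEdges es f i v)
... | no _  | yes _   = multiplicity-tails-colorEdges es f i v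
... | no _  | no _    = multiplicity-tails-colorEdges es f i v

-- H is definitionally state (edges H) (free H) by record η.
colorTails-atMostOnce : ∀ {n k ℓ} {H : GameState n k} → Configuration ℓ H →
  ∀ i → AtMostOnce (tails (colorEdges H i))
colorTails-atMostOnce {H = H} C i v =
  subst₂ _≤_ (sym (multiplicity-tails-colorEdges (edges H) (free H) i v)) (configuration-ownedPebbles C v i)
    (m≤n+m (outdegree (edges H) v i) (free H v i))

lemma4 : (n k ℓ : ℕ) → ℓ < 2 * k →
    (H : GameState n k) → Configuration ℓ H →
    (i : Fin k) → Sparse10 (colorEdges H i)
lemma4 n k ℓ _ H C i = atMostOnce-tails⇒Sparse10 (colorTails-atMostOnce C i)
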